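{- Let $f,g$ be complex-valued functions of two complex variables with $f\perp g$. Let $\{a_i\},\{b_i\}$ be complex sequences, $x$ a complex number and $m\ge 0$ an integer, such that $f(a_0,b_0)\neq0$ and $g(b_j,b_0)\neq 0$, $f(a_j,x)\neq 0$ for $1\le j\le m$. Then $$\sum_{k=0}^{m}\frac{f(a_k,b_k)}{f(a_0,b_0)}\frac{\prod_{j=0}^{k-1}f(a_j,b_0)}{\prod_{j=1}^{k}g(b_j,b_0)}\frac{\prod_{j=0}^{k-1}g(b_j,x)}{\prod_{j=1}^{k}f(a_j,x)}=\frac{\prod_{j=1}^{m}f(a_j,b_0)}{\prod_{j=1}^{m}g(b_j,b_0)}\frac{\prod_{j=1}^{m}g(b_j,x)}{\prod_{j=1}^{m}f(a_j,x)}.$$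
   Context: For complex functions $f,g$ of two variables, $f\perp g$ means that for all complex numbers $a,b,c,x$: $$g(a,b)f(x,c)-g(a,c)f(x,b)+g(b,c)f(x,a)=0.$$ Empty products (upper index one less than lower index) equal $1$. -}

module Defs where

open import Level using (Level; _⊔_) renaming (suc to lsuc)
open import Data.Nat using (ℕ; zero; suc; _≤_)
open import Relation.Nullary using (¬_)
open import Algebra.Bundles using (CommutativeRing)

-- A field: a commutative ring with 0 ≠ 1 and a total inverse operation
-- that is a genuine inverse on nonzero elements (the value of 0⁻¹ is
-- irrelevant).  ℂ is the intended instance.
record Field (c ℓ : Level) : Set (lsuc (c ⊔ ℓ)) where
  field
    commutativeRing : CommutativeRing c ℓ
  open CommutativeRing commutativeRing public
  field
    _⁻¹      : Carrier → Carrier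
    0≉1      : ¬ (0# ≈ 1#)
    ⁻¹-inverseʳ : ∀ x → ¬ (x ≈ 0#) → (x * (x ⁻¹)) ≈ 1#
    ⁻¹-cong  : ∀ {x y} → x ≈ y → (x ⁻¹) ≈ (y ⁻¹)

module FieldOps {c ℓ : Level} (F : Field c ℓ) where
  open Field F hiding (zero)

  infixl 7 _÷_
  _÷_ : Carrier → Carrier → Carrier
  x ÷ y = x * (y ⁻¹)

  -- prodFrom h lo n = h lo * h (lo+1) * ... * h (lo+n-1)  (empty product = 1)
  -- so  ∏_{j=lo}^{lo+n-1} h j = prodFrom h lo n.
  prodFrom : (ℕ → Carrier) → ℕ → ℕ → Carrier
  prodFrom h lo zero    = 1#
  prodFrom h lo (suc n) = h lo * prodFrom h (suc lo) n

  sumTo : (ℕ → Carrier) → ℕ → Carrier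
  sumTo h zero    = h zero
  sumTo h (suc m) = sumTo h m + h (suc m)

  _⊥_ : (Carrier → Carrier → Carrier) → (Carrier → Carrier → Carrier) → Set (c ⊔ ℓ)
  f ⊥ g = ∀ a b c x →
    ((g a b * f x c) - (g a c * f x b)) + (g b c * f x a) ≈ 0#

{-# OPTIONS --safe #-}
-- The sum telescopes.  Write R m for the right-hand side.  With a′ = a_{m+1}, b′ = b_{m+1} and
-- D = g(b′,b₀) f(a′,x), the (m+1)-st summand is R m · g(b₀,x) f(a′,b′) / D, while
-- R (m+1) = R m · g(b′,x) f(a′,b₀) / D.  So R m + (summand) = R (m+1) says exactly
-- D + g(b₀,x) f(a′,b′) = g(b′,x) f(a′,b₀), which is f ⊥ g at (b′, b₀, x, a′).

module Submission where

open import Defs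
open import Level using (Level)
open import Data.Nat using (ℕ; zero; suc; _≤_; _<_; s≤s; z≤n)
import Data.Nat as ℕ
open import Data.Nat.Properties using (≤-refl; ≤-trans; n≤1+n; n<1+n; m<n⇒m<1+n)
import Data.Nat.Properties as ℕₚ
open import Data.Product using (_×_; proj₁; proj₂)
open import Function using (_∘_)
open import Relation.Nullary using (¬_)
open import Relation.Binary.PropositionalEquality using (cong)
import Algebra.Solver.CommutativeMonoid as CommutativeMonoidSolver
import Algebra.Properties.CommutativeSemigroup as CommutativeSemigroupProperties

module FieldProperties {c ℓ : Level} (F : Field c ℓ) where
  open Field F hiding (zero)
  open FieldOps F
  open CommutativeSemigroupProperties *-commutativeSemigroup using (interchange)
  module +-Solver = CommutativeMonoidSolver +-commutativeMonoid
  open import Relation.Binary.Reasoning.Setoid setoid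

  x-y+z≈0⇒x+z≈y : ∀ {x y z} → (x - y) + z ≈ 0# → x + z ≈ y
  x-y+z≈0⇒x+z≈y {x} {y} {z} x-y+z≈0 = begin
    x + z                ≈⟨ sym (+-identityʳ _) ⟩
    (x + z) + 0#         ≈⟨ +-congˡ (sym (-‿inverseˡ y)) ⟩
    (x + z) + (- y + y)  ≈⟨ +-Solver.solve 4 (λ x z -y y → (x ⊕ z) ⊕ (-y ⊕ y) ⊜ ((x ⊕ -y) ⊕ z) ⊕ y)
                              refl x z (- y) y ⟩
    ((x - y) + z) + y    ≈⟨ +-congʳ x-y+z≈0 ⟩
    0# + y               ≈⟨ +-identityˡ y ⟩
    y                    ∎
    where open +-Solver using (_⊕_; _⊜_)

  ⊥-three-term : ∀ {f g} → f ⊥ g → ∀ a b c x → g a b * f x c + g b c * f x a ≈ g a c * f x b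
  ⊥-three-term f⊥g a b c x = x-y+z≈0⇒x+z≈y (f⊥g a b c x)

  ⁻¹-inverseˡ : ∀ x → x ≉ 0# → x ⁻¹ * x ≈ 1#
  ⁻¹-inverseˡ x x≉0 = trans (*-comm _ _) (⁻¹-inverseʳ x x≉0)

  [x*y]*[x⁻¹*y⁻¹]≈1 : ∀ {x y} → x ≉ 0# → y ≉ 0# → (x * y) * (x ⁻¹ * y ⁻¹) ≈ 1#
  [x*y]*[x⁻¹*y⁻¹]≈1 {x} {y} x≉0 y≉0 = begin
    (x * y) * (x ⁻¹ * y ⁻¹)  ≈⟨ interchange x y (x ⁻¹) (y ⁻¹) ⟩
    (x * x ⁻¹) * (y * y ⁻¹)  ≈⟨ *-cong (⁻¹-inverseʳ x x≉0) (⁻¹-inverseʳ y y≉0) ⟩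
    1# * 1#                  ≈⟨ *-identityˡ 1# ⟩
    1#                       ∎

  x≉0∧y≉0⇒x*y≉0 : ∀ {x y} → x ≉ 0# → y ≉ 0# → x * y ≉ 0#
  x≉0∧y≉0⇒x*y≉0 {x} {y} x≉0 y≉0 x*y≈0 = 0≉1 (begin
    0#                       ≈⟨ sym (zeroˡ _) ⟩
    0# * (x ⁻¹ * y ⁻¹)       ≈⟨ *-congʳ (sym x*y≈0) ⟩
    (x * y) * (x ⁻¹ * y ⁻¹)  ≈⟨ [x*y]*[x⁻¹*y⁻¹]≈1 x≉0 y≉0 ⟩
    1#                       ∎)

  ⁻¹-distrib-* : ∀ {x y} → x ≉ 0# → y ≉ 0# → (x * y) ⁻¹ ≈ x ⁻¹ * y ⁻¹
  ⁻¹-distrib-* {x} {y} x≉0 y≉0 = begin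
    (x * y) ⁻¹                               ≈⟨ sym (*-identityʳ _) ⟩
    (x * y) ⁻¹ * 1#                          ≈⟨ *-congˡ (sym ([x*y]*[x⁻¹*y⁻¹]≈1 x≉0 y≉0)) ⟩
    (x * y) ⁻¹ * ((x * y) * (x ⁻¹ * y ⁻¹))  ≈⟨ sym (*-assoc _ _ _) ⟩
    ((x * y) ⁻¹ * (x * y)) * (x ⁻¹ * y ⁻¹)  ≈⟨ *-congʳ (⁻¹-inverseˡ _ (x≉0∧y≉0⇒x*y≉0 x≉0 y≉0)) ⟩
    1# * (x ⁻¹ * y ⁻¹)                       ≈⟨ *-identityˡ _ ⟩
    x ⁻¹ * y ⁻¹                              ∎

  1+x÷y≈[y+x]÷y : ∀ {x y} → y ≉ 0# → 1# + x ÷ y ≈ (y + x) ÷ y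
  1+x÷y≈[y+x]÷y {x} {y} y≉0 = begin
    1# + x ÷ y      ≈⟨ +-congʳ (sym (⁻¹-inverseʳ y y≉0)) ⟩
    y ÷ y + x ÷ y   ≈⟨ sym (distribʳ _ _ _) ⟩
    (y + x) ÷ y     ∎

  prodFrom-snoc : ∀ h lo n → prodFrom h lo (suc n) ≈ prodFrom h lo n * h (lo ℕ.+ n)
  prodFrom-snoc h lo zero = begin
    h lo * 1#       ≈⟨ *-comm _ _ ⟩
    1# * h lo       ≡⟨ cong (λ i → 1# * h i) (ℕₚ.+-identityʳ lo) ⟨
    1# * h (lo ℕ.+ 0) ∎
  prodFrom-snoc h lo (suc n) = begin
    h lo * prodFrom h (suc lo) (suc n)               ≈⟨ *-congˡ (prodFrom-snoc h (suc lo) n) ⟩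
    h lo * (prodFrom h (suc lo) n * h (suc lo ℕ.+ n))  ≈⟨ *-assoc _ _ _ ⟨
    prodFrom h lo (suc n) * h (suc lo ℕ.+ n)           ≡⟨ cong (λ i → prodFrom h lo (suc n) * h i) (ℕₚ.+-suc lo n) ⟨
    prodFrom h lo (suc n) * h (lo ℕ.+ suc n)           ∎

  prodFrom-≉0 : ∀ h lo n → (∀ i → i < n → h (lo ℕ.+ i) ≉ 0#) → prodFrom h lo n ≉ 0#
  prodFrom-≉0 h lo zero    _   = 0≉1 ∘ sym
  prodFrom-≉0 h lo (suc n) h≉0 =
    x≉0∧y≉0⇒x*y≉0 (prodFrom-≉0 h lo n (λ i → h≉0 i ∘ m<n⇒m<1+n)) (h≉0 n (n<1+n n))
    ∘ trans (sym (prodFrom-snoc h lo n))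

  prodFrom-snoc-⁻¹ : ∀ h lo n → prodFrom h lo n ≉ 0# → h (lo ℕ.+ n) ≉ 0# →
                     prodFrom h lo (suc n) ⁻¹ ≈ prodFrom h lo n ⁻¹ * h (lo ℕ.+ n) ⁻¹
  prodFrom-snoc-⁻¹ h lo n p≉0 h≉0 = trans (⁻¹-cong (prodFrom-snoc h lo n)) (⁻¹-distrib-* p≉0 h≉0)

  sumTo-telescope : ∀ (u t : ℕ → Carrier) n → u 0 ≈ t 0 →
                    (∀ k → k < n → t k + u (suc k) ≈ t (suc k)) → sumTo u n ≈ t n
  sumTo-telescope u t zero    u₀≈t₀ _    = u₀≈t₀
  sumTo-telescope u t (suc n) u₀≈t₀ step = trans
    (+-congʳ (sumTo-telescope u t n u₀≈t₀ (λ k → step k ∘ m<n⇒m<1+n)))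
    (step n (n<1+n n))

module _ {c ℓ : Level} (F : Field c ℓ) where
  open Field F hiding (zero)
  open FieldOps F
  open FieldProperties F
  module *-Solver = CommutativeMonoidSolver *-commutativeMonoid
  open import Relation.Binary.Reasoning.Setoid setoid

  module Corollary3p1 (f g : Carrier → Carrier → Carrier) (f⊥g : f ⊥ g) (a b : ℕ → Carrier) (x : Carrier) where
    Nondegenerate : ℕ → Set ℓ
    Nondegenerate m = ∀ j → 1 ≤ j → j ≤ m → g (b j) (b 0) ≉ 0# × f (a j) x ≉ 0#

    Nondegenerate-mono : ∀ {k m} → k ≤ m → Nondegenerate m → Nondegenerate k
    Nondegenerate-mono k≤m nd j 1≤j j≤k = nd j 1≤j (≤-trans j≤k k≤m)

    P G H Q : ℕ → Carrier
    P = prodFrom (λ j → f (a j) (b 0)) 1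
    G = prodFrom (λ j → g (b j) (b 0)) 1
    H = prodFrom (λ j → g (b j) x) 1
    Q = prodFrom (λ j → f (a j) x) 1

    G≉0 : ∀ {m} → Nondegenerate m → G m ≉ 0#
    G≉0 {m} nd = prodFrom-≉0 _ 1 m (λ i i<m → proj₁ (nd (suc i) (s≤s z≤n) i<m))

    Q≉0 : ∀ {m} → Nondegenerate m → Q m ≉ 0#
    Q≉0 {m} nd = prodFrom-≉0 _ 1 m (λ i i<m → proj₂ (nd (suc i) (s≤s z≤n) i<m))

    term : ℕ → Carrier
    term k = (f (a k) (b k) ÷ f (a 0) (b 0))
           * (prodFrom (λ j → f (a j) (b 0)) 0 k ÷ G k)
           * (prodFrom (λ j → g (b j) x) 0 k ÷ Q k)

    ratio : ℕ → Carrier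
    ratio m = (P m ÷ G m) * (H m ÷ Q m)

    term₀≈ratio₀ : f (a 0) (b 0) ≉ 0# → term 0 ≈ ratio 0
    term₀≈ratio₀ f₀₀≉0 = *-congʳ (trans (*-congʳ (⁻¹-inverseʳ _ f₀₀≉0)) (*-identityˡ _))

    module Step (k : ℕ) (nd : Nondegenerate (suc k)) where
      f₀₀ f′′ f′₀ f′x g₀x g′₀ g′x D : Carrier
      f₀₀ = f (a 0) (b 0)
      f′′ = f (a (suc k)) (b (suc k))
      f′₀ = f (a (suc k)) (b 0)
      f′x = f (a (suc k)) x
      g₀x = g (b 0) x
      g′₀ = g (b (suc k)) (b 0)
      g′x = g (b (suc k)) x
      D   = g′₀ * f′x

      g′₀≉0 : g′₀ ≉ 0#
      g′₀≉0 = proj₁ (nd (suc k) (s≤s z≤n) ≤-refl)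

      f′x≉0 : f′x ≉ 0#
      f′x≉0 = proj₂ (nd (suc k) (s≤s z≤n) ≤-refl)

      G-snoc-⁻¹ : G (suc k) ⁻¹ ≈ G k ⁻¹ * g′₀ ⁻¹
      G-snoc-⁻¹ = prodFrom-snoc-⁻¹ _ 1 k (G≉0 (Nondegenerate-mono (n≤1+n k) nd)) g′₀≉0

      Q-snoc-⁻¹ : Q (suc k) ⁻¹ ≈ Q k ⁻¹ * f′x ⁻¹
      Q-snoc-⁻¹ = prodFrom-snoc-⁻¹ _ 1 k (Q≉0 (Nondegenerate-mono (n≤1+n k) nd)) f′x≉0

      D⁻¹ : D ⁻¹ ≈ g′₀ ⁻¹ * f′x ⁻¹
      D⁻¹ = ⁻¹-distrib-* g′₀≉0 f′x≉0

      term-suc : f₀₀ ≉ 0# → term (suc k) ≈ ratio k * ((g₀x * f′′) ÷ D)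
      term-suc f₀₀≉0 = begin
        term (suc k)
          ≈⟨ *-cong (*-congˡ (*-congˡ G-snoc-⁻¹)) (*-congˡ Q-snoc-⁻¹) ⟩
        ((f′′ * f₀₀ ⁻¹) * ((f₀₀ * P k) * (G k ⁻¹ * g′₀ ⁻¹))) * ((g₀x * H k) * (Q k ⁻¹ * f′x ⁻¹))
          ≈⟨ solve 10 (λ f′′ f₀₀⁻¹ f₀₀ p G⁻¹ g′₀⁻¹ g₀x h Q⁻¹ f′x⁻¹ →
                 ((f′′ ⊕ f₀₀⁻¹) ⊕ ((f₀₀ ⊕ p) ⊕ (G⁻¹ ⊕ g′₀⁻¹))) ⊕ ((g₀x ⊕ h) ⊕ (Q⁻¹ ⊕ f′x⁻¹))
               ⊜ (f₀₀⁻¹ ⊕ f₀₀) ⊕ (((p ⊕ G⁻¹) ⊕ (h ⊕ Q⁻¹)) ⊕ ((g₀x ⊕ f′′) ⊕ (g′₀⁻¹ ⊕ f′x⁻¹))))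
               refl f′′ (f₀₀ ⁻¹) f₀₀ (P k) (G k ⁻¹) (g′₀ ⁻¹) g₀x (H k) (Q k ⁻¹) (f′x ⁻¹) ⟩
        (f₀₀ ⁻¹ * f₀₀) * (ratio k * ((g₀x * f′′) * (g′₀ ⁻¹ * f′x ⁻¹)))
          ≈⟨ trans (*-congʳ (⁻¹-inverseˡ f₀₀ f₀₀≉0)) (*-identityˡ _) ⟩
        ratio k * ((g₀x * f′′) * (g′₀ ⁻¹ * f′x ⁻¹))
          ≈⟨ *-congˡ (*-congˡ D⁻¹) ⟨
        ratio k * ((g₀x * f′′) ÷ D)
          ∎
        where open *-Solver

      ratio-suc : ratio (suc k) ≈ ratio k * ((g′x * f′₀) ÷ D)
      ratio-suc = begin
        ratio (suc k)
          ≈⟨ *-cong (*-cong (prodFrom-snoc _ 1 k) G-snoc-⁻¹) (*-cong (prodFrom-snoc _ 1 k) Q-snoc-⁻¹) ⟩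
        ((P k * f′₀) * (G k ⁻¹ * g′₀ ⁻¹)) * ((H k * g′x) * (Q k ⁻¹ * f′x ⁻¹))
          ≈⟨ solve 8 (λ p f′₀ G⁻¹ g′₀⁻¹ h g′x Q⁻¹ f′x⁻¹ →
                 ((p ⊕ f′₀) ⊕ (G⁻¹ ⊕ g′₀⁻¹)) ⊕ ((h ⊕ g′x) ⊕ (Q⁻¹ ⊕ f′x⁻¹))
               ⊜ ((p ⊕ G⁻¹) ⊕ (h ⊕ Q⁻¹)) ⊕ ((g′x ⊕ f′₀) ⊕ (g′₀⁻¹ ⊕ f′x⁻¹)))
               refl (P k) f′₀ (G k ⁻¹) (g′₀ ⁻¹) (H k) g′x (Q k ⁻¹) (f′x ⁻¹) ⟩
        ratio k * ((g′x * f′₀) * (g′₀ ⁻¹ * f′x ⁻¹))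
          ≈⟨ *-congˡ (*-congˡ D⁻¹) ⟨
        ratio k * ((g′x * f′₀) ÷ D)
          ∎
        where open *-Solver

      ratio-step : f₀₀ ≉ 0# → ratio k + term (suc k) ≈ ratio (suc k)
      ratio-step f₀₀≉0 = begin
        ratio k + term (suc k)                      ≈⟨ +-congˡ (term-suc f₀₀≉0) ⟩
        ratio k + ratio k * ((g₀x * f′′) ÷ D)       ≈⟨ +-congʳ (*-identityʳ _) ⟨
        ratio k * 1# + ratio k * ((g₀x * f′′) ÷ D)  ≈⟨ distribˡ _ _ _ ⟨
        ratio k * (1# + (g₀x * f′′) ÷ D)            ≈⟨ *-congˡ (1+x÷y≈[y+x]÷y (x≉0∧y≉0⇒x*y≉0 g′₀≉0 f′x≉0)) ⟩
        ratio k * ((D + g₀x * f′′) ÷ D)             ≈⟨ *-congˡ (*-congʳ (⊥-three-term f⊥g (b (suc k)) (b 0) x (a (suc k)))) ⟩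
        ratio k * ((g′x * f′₀) ÷ D)                 ≈⟨ ratio-suc ⟨
        ratio (suc k)                               ∎

corollary3p1 : ∀ {c ℓ : Level} (F : Field c ℓ) →
  let open Field F hiding (zero)
      open FieldOps F
  in (f g : Carrier → Carrier → Carrier) → f ⊥ g →
     (a b : ℕ → Carrier) (x : Carrier) (m : ℕ) →
     ¬ (f (a 0) (b 0) ≈ 0#) →
     (∀ j → 1 ≤ j → j ≤ m → ¬ (g (b j) (b 0) ≈ 0#) × ¬ (f (a j) x ≈ 0#)) →
     sumTo (λ k →
         (f (a k) (b k) ÷ f (a 0) (b 0))
       * (prodFrom (λ j → f (a j) (b 0)) 0 k ÷ prodFrom (λ j → g (b j) (b 0)) 1 k)
       * (prodFrom (λ j → g (b j) x) 0 k ÷ prodFrom (λ j → f (a j) x) 1 k)) m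
     ≈ (prodFrom (λ j → f (a j) (b 0)) 1 m ÷ prodFrom (λ j → g (b j) (b 0)) 1 m)
       * (prodFrom (λ j → g (b j) x) 1 m ÷ prodFrom (λ j → f (a j) x) 1 m)
corollary3p1 F f g f⊥g a b x m f₀₀≉0 nd =
  sumTo-telescope term ratio m (term₀≈ratio₀ f₀₀≉0)
    (λ k k<m → Step.ratio-step k (Nondegenerate-mono k<m nd) f₀₀≉0)
  where
  open FieldProperties F using (sumTo-telescope)
  open Corollary3p1 F f g f⊥g a b x
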